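{- Let $n$ be a positive integer and let $M=2M'$ for some odd positive integer $M'$. Then $\mathcal D(n,M)\le 1+\mathcal D(n,M')$.
   Context: $\mathsf{Ham}(x)$ is the Hamming weight of $x\in\mathbb F_2^n$. $\mathcal D(n,M)$ denotes the largest dimension of an affine subspace $C$ of $\mathbb F_2^n$ such that for some $0\le a\le M$ there exists exactly one point $x_0\in C$ with $\mathsf{Ham}(x_0)\equiv a\pmod M$. -}

module Defs where

open import Data.Bool using (Bool; true; false; _xor_)
open import Data.Nat using (ℕ; zero; suc; _+_; _*_; _≤_)
open import Data.Vec using (Vec; []; _∷_; zipWith; replicate; count)
open import Data.Product using (Σ; ∃; _×_; _,_)
open import Relation.Binary.PropositionalEquality using (_≡_)
open import Data.Integer using (ℤ; +_; _-_)
open import Data.Integer.Divisibility using (_∣_)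
open import Data.Bool using (T)
open import Function using (id)

-- Vectors of F₂ⁿ, with F₂ = Bool (true = 1), addition = xor.
F2^ : ℕ → Set
F2^ n = Vec Bool n

zeroV : ∀ {n} → F2^ n
zeroV = replicate _ false

_⊕_ : ∀ {n} → F2^ n → F2^ n → F2^ n
_⊕_ = zipWith _xor_

Ham : ∀ {n} → F2^ n → ℕ
Ham x = count (λ b → Data.Bool._≟_ b true) x

lincomb : ∀ {n k} → Vec (F2^ n) k → Vec Bool k → F2^ n
lincomb []       []            = zeroV
lincomb (v ∷ vs) (false ∷ cs)  = lincomb vs cs
lincomb (v ∷ vs) (true ∷ cs)   = v ⊕ lincomb vs cs

LinIndep : ∀ {n k} → Vec (F2^ n) k → Set
LinIndep {k = k} vs = ∀ c → lincomb vs c ≡ zeroV → c ≡ replicate k false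

record AffSub (n k : ℕ) : Set where
  constructor affSub
  field
    base  : F2^ n
    dirs  : Vec (F2^ n) k
    indep : LinIndep dirs

_∈C_ : ∀ {n k} → F2^ n → AffSub n k → Set
y ∈C C = ∃ λ c → y ≡ AffSub.base C ⊕ lincomb (AffSub.dirs C) c

_≡_[mod_] : ℕ → ℕ → ℕ → Set
a ≡ b [mod M ] = (+ M) ∣ ((+ a) - (+ b))

UniquePt : ∀ {n k} → ℕ → ℕ → AffSub n k → Set
UniquePt M a C =
  ∃ λ x₀ → (x₀ ∈C C) × (Ham x₀ ≡ a [mod M ]) ×
    (∀ y → y ∈C C → Ham y ≡ a [mod M ] → y ≡ x₀)

Attained : ℕ → ℕ → ℕ → Set
Attained n M d = Σ (AffSub n d) λ C → ∃ λ a → a ≤ M × UniquePt M a C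

IsD : ℕ → ℕ → ℕ → Set
IsD n M d = Attained n M d × (∀ d' → Attained n M d' → d' ≤ d)

Odd : ℕ → Set
Odd m = ∃ λ j → m ≡ suc (2 * j)

-- The even-weight vectors of the direction space of a (k+1)-dimensional affine
-- subspace C form a subspace of dimension at least k, so C contains a
-- k-dimensional affine subspace C' through the distinguished point x₀ on which
-- the Hamming weight has constant parity.  If exactly one point of C has weight
-- ≡ a (mod 2M'), then exactly one point of C' has weight ≡ a (mod M'): any
-- such point agrees with x₀ in weight modulo 2 as well, hence modulo 2M' as M'
-- is odd, so it is x₀.
module Submission where

open import Defs
open import Data.Nat using (ℕ; _+_; _*_; _≤_)
open import Relation.Binary.PropositionalEquality using (_≡_)

open import Algebra.Bundles using (CommutativeRing)
open import Data.Bool using (Bool; true; false; _xor_; if_then_else_)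
open import Data.Bool.Properties
  using (xor-assoc; xor-identityˡ; xor-identityʳ; xor-same; xor-∧-commutativeRing)
open import Algebra.Properties.CommutativeSemigroup
  (CommutativeRing.+-commutativeSemigroup xor-∧-commutativeRing)
  using () renaming (interchange to xor-interchange)
open import Data.Integer using (+_; _⊖_; ∣_∣) renaming (_+_ to _+ᶻ_; _-_ to _-ᶻ_)
import Data.Integer.Properties as ℤ
import Data.Integer.Divisibility.Signed as ℤ
open import Data.Integer.Tactic.RingSolver using (solve-∀)
open import Data.Nat using (zero; suc; z≤n; s≤s; _∸_; _%_; _/_; NonZero)
open import Data.Nat.Coprimality using (Coprime; 1-coprimeTo; coprime-+; coprime-divisor)
open import Data.Nat.DivMod using (m≡m%n+[m/n]*n; m%n≤n)
open import Data.Nat.Divisibility as ℕ using (divides; n∣m*n; m∣m*n; *-monoˡ-∣)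
open import Data.Nat.Properties using (*-comm; *-suc; m+n∸m≡n; m≤m+n)
open import Data.Product using (∃; _,_)
open import Data.Vec using (Vec; []; _∷_; map)
open import Data.Vec.Properties using (∷-injectiveˡ; ∷-injectiveʳ; zipWith-assoc; zipWith-identityˡ; zipWith-identityʳ)
open import Data.Vec.Relation.Unary.All using (All; []; _∷_; universal)
open import Data.Vec.Relation.Unary.All.Properties using (map⁺)
open import Relation.Binary.PropositionalEquality
  using (refl; sym; trans; cong; cong₂; subst; module ≡-Reasoning)

private
  variable
    n k m : ℕ

mod-sym : ∀ a b {M} → a ≡ b [mod M ] → b ≡ a [mod M ]
mod-sym a b {M} a≡b = subst (M ℕ.∣_) (|+m-+n|≡|+n-+m| a b) a≡b
  where
  |+m-+n|≡|+n-+m| : ∀ a b → ∣ + a -ᶻ + b ∣ ≡ ∣ + b -ᶻ + a ∣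
  |+m-+n|≡|+n-+m| a b = begin
    ∣ + a -ᶻ + b ∣ ≡⟨ cong ∣_∣ (ℤ.m-n≡m⊖n a b) ⟩
    ∣ a ⊖ b ∣      ≡⟨ ℤ.∣m⊖n∣≡∣n⊖m∣ a b ⟩
    ∣ b ⊖ a ∣      ≡⟨ cong ∣_∣ (ℤ.m-n≡m⊖n b a) ⟨
    ∣ + b -ᶻ + a ∣ ∎
    where open ≡-Reasoning

mod-trans : ∀ a b c {M} → a ≡ b [mod M ] → b ≡ c [mod M ] → a ≡ c [mod M ]
mod-trans a b c {M} a≡b b≡c = ℤ.∣⇒∣ᵤ (subst (+ M ℤ.∣_) (telescope (+ a) (+ b) (+ c))
  (ℤ.∣m∣n⇒∣m+n {+ M} {+ a -ᶻ + b} {+ b -ᶻ + c} (ℤ.∣ᵤ⇒∣ a≡b) (ℤ.∣ᵤ⇒∣ b≡c)))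
  where
  telescope : ∀ x y z → (x -ᶻ y) +ᶻ (y -ᶻ z) ≡ x -ᶻ z
  telescope = solve-∀

mod-∣ : ∀ a b {M N} → M ℕ.∣ N → a ≡ b [mod N ] → a ≡ b [mod M ]
mod-∣ _ _ = ℕ.∣-trans

m+k*n≡m-mod : ∀ m k n → (m + k * n) ≡ m [mod n ]
m+k*n≡m-mod m k n = subst (n ℕ.∣_) (sym |m+k*n-m|) (n∣m*n k)
  where
  |m+k*n-m| : ∣ + (m + k * n) -ᶻ + m ∣ ≡ k * n
  |m+k*n-m| = begin
    ∣ + (m + k * n) -ᶻ + m ∣ ≡⟨ cong ∣_∣ (ℤ.m-n≡m⊖n (m + k * n) m) ⟩
    ∣ (m + k * n) ⊖ m ∣      ≡⟨ cong ∣_∣ (ℤ.⊖-≥ (m≤m+n m (k * n))) ⟩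
    (m + k * n) ∸ m          ≡⟨ m+n∸m≡n m (k * n) ⟩
    k * n                    ∎
    where open ≡-Reasoning

m≡m%n-mod : ∀ m n .{{_ : NonZero n}} → m ≡ m % n [mod n ]
m≡m%n-mod m n = subst (λ x → x ≡ m % n [mod n ]) (sym (m≡m%n+[m/n]*n m n))
  (m+k*n≡m-mod (m % n) (m / n) n)

Odd⇒Coprime-2 : Odd m → Coprime m 2
Odd⇒Coprime-2 (zero  , refl) = 1-coprimeTo 2
Odd⇒Coprime-2 (suc j , refl) =
  subst (λ x → Coprime x 2) (cong suc (sym (*-suc 2 j))) (coprime-+ (Odd⇒Coprime-2 (j , refl)))

coprime-∣∣⇒*∣ : ∀ {m n x} → Coprime m n → m ℕ.∣ x → n ℕ.∣ x → m * n ℕ.∣ x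
coprime-∣∣⇒*∣ {m} {n} m⊥n m∣x (divides q refl) =
  *-monoˡ-∣ n (coprime-divisor m⊥n (subst (m ℕ.∣_) (*-comm q n) m∣x))

mod-2*odd : ∀ a b {M} → Odd M → a ≡ b [mod 2 ] → a ≡ b [mod M ] → a ≡ b [mod 2 * M ]
mod-2*odd a b {M} odd a≡b[2] a≡b[M] =
  subst (ℕ._∣ ∣ + a -ᶻ + b ∣) (*-comm M 2) (coprime-∣∣⇒*∣ (Odd⇒Coprime-2 odd) a≡b[M] a≡b[2])

⊕-assoc : (x y z : F2^ n) → (x ⊕ y) ⊕ z ≡ x ⊕ (y ⊕ z)
⊕-assoc = zipWith-assoc xor-assoc

⊕-identityˡ : (x : F2^ n) → zeroV ⊕ x ≡ x
⊕-identityˡ = zipWith-identityˡ xor-identityˡ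

⊕-identityʳ : (x : F2^ n) → x ⊕ zeroV ≡ x
⊕-identityʳ = zipWith-identityʳ xor-identityʳ

⊕-self : (x : F2^ n) → x ⊕ x ≡ zeroV
⊕-self []      = refl
⊕-self (b ∷ x) = cong₂ _∷_ (xor-same b) (⊕-self x)

⊕-interchange : (x y z w : F2^ n) → (x ⊕ y) ⊕ (z ⊕ w) ≡ (x ⊕ z) ⊕ (y ⊕ w)
⊕-interchange []      []      []      []      = refl
⊕-interchange (a ∷ x) (b ∷ y) (c ∷ z) (d ∷ w) =
  cong₂ _∷_ (xor-interchange a b c d) (⊕-interchange x y z w)

infix 25 _·_

_·_ : Bool → F2^ n → F2^ n
b · v = if b then v else zeroV

xor-· : ∀ a b (v : F2^ n) → (a xor b) · v ≡ a · v ⊕ b · v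
xor-· false b     v = sym (⊕-identityˡ (b · v))
xor-· true  false v = sym (⊕-identityʳ v)
xor-· true  true  v = sym (⊕-self v)

lincomb-∷ : ∀ (v : F2^ n) (vs : Vec (F2^ n) k) b c → lincomb (v ∷ vs) (b ∷ c) ≡ b · v ⊕ lincomb vs c
lincomb-∷ v vs false c = sym (⊕-identityˡ (lincomb vs c))
lincomb-∷ v vs true  c = refl

lincomb-zeroV : (vs : Vec (F2^ n) k) → lincomb vs zeroV ≡ zeroV
lincomb-zeroV []       = refl
lincomb-zeroV (v ∷ vs) = lincomb-zeroV vs

lincomb-⊕ : (vs : Vec (F2^ n) k) (c c' : Vec Bool k) →
            lincomb vs (c ⊕ c') ≡ lincomb vs c ⊕ lincomb vs c'
lincomb-⊕ []       []      []        = sym (⊕-self zeroV)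
lincomb-⊕ (v ∷ vs) (a ∷ c) (b ∷ c') = begin
  lincomb (v ∷ vs) ((a xor b) ∷ c ⊕ c')               ≡⟨ lincomb-∷ v vs (a xor b) (c ⊕ c') ⟩
  (a xor b) · v ⊕ lincomb vs (c ⊕ c')                 ≡⟨ cong₂ _⊕_ (xor-· a b v) (lincomb-⊕ vs c c') ⟩
  (a · v ⊕ b · v) ⊕ (lincomb vs c ⊕ lincomb vs c')    ≡⟨ ⊕-interchange (a · v) (b · v) _ _ ⟩
  (a · v ⊕ lincomb vs c) ⊕ (b · v ⊕ lincomb vs c')    ≡⟨ cong₂ _⊕_ (lincomb-∷ v vs a c) (lincomb-∷ v vs b c') ⟨
  lincomb (v ∷ vs) (a ∷ c) ⊕ lincomb (v ∷ vs) (b ∷ c') ∎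
  where open ≡-Reasoning

parity : F2^ n → Bool
parity []      = false
parity (b ∷ x) = b xor parity x

Even : F2^ n → Set
Even x = parity x ≡ false

parity-⊕ : (x y : F2^ n) → parity (x ⊕ y) ≡ parity x xor parity y
parity-⊕ []      []      = refl
parity-⊕ (a ∷ x) (b ∷ y) =
  trans (cong ((a xor b) xor_) (parity-⊕ x y)) (xor-interchange a b (parity x) (parity y))

parity-zeroV : ∀ n → parity (zeroV {n}) ≡ false
parity-zeroV zero    = refl
parity-zeroV (suc n) = parity-zeroV n

lincomb-Even : {vs : Vec (F2^ n) k} → All Even vs → ∀ c → Even (lincomb vs c)
lincomb-Even {n}         []       []          = parity-zeroV n
lincomb-Even             (_ ∷ es) (false ∷ c) = lincomb-Even es c
lincomb-Even {vs = v ∷ _} (e ∷ es) (true ∷ c)  =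
  trans (parity-⊕ v _) (cong₂ _xor_ e (lincomb-Even es c))

Ham-parity : (x : F2^ n) → ∃ λ q → Ham x ≡ (if parity x then 1 else 0) + q * 2
Ham-parity []          = 0 , refl
Ham-parity (false ∷ x) = Ham-parity x
Ham-parity (true ∷ x) with parity x | Ham-parity x
... | false | q , h = q , cong suc h
... | true  | q , h = suc q , cong suc h

parity⇒Ham-mod-2 : (x y : F2^ n) → parity x ≡ parity y → Ham x ≡ Ham y [mod 2 ]
parity⇒Ham-mod-2 x y px≡py with Ham-parity x | Ham-parity y
... | q , hx | q' , hy = mod-trans (Ham x) r (Ham y) Hx≡r (mod-sym (Ham y) r Hy≡r)
  where
  r : ℕ
  r = if parity y then 1 else 0
  Hx≡r : Ham x ≡ r [mod 2 ]
  Hx≡r = subst (λ h → h ≡ r [mod 2 ])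
    (sym (trans hx (cong (λ b → (if b then 1 else 0) + q * 2) px≡py))) (m+k*n≡m-mod r q 2)
  Hy≡r : Ham y ≡ r [mod 2 ]
  Hy≡r = subst (λ h → h ≡ r [mod 2 ]) (sym hy) (m+k*n≡m-mod r q' 2)

absorb : F2^ n → F2^ n → F2^ n
absorb v w = parity w · v ⊕ w

absorb-Even : {v : F2^ n} → parity v ≡ true → ∀ w → Even (absorb v w)
absorb-Even {v = v} pv w with parity w in pw
... | false = trans (cong parity (⊕-identityˡ w)) pw
... | true  = trans (parity-⊕ v w) (cong₂ _xor_ pv pw)

lincomb-map-absorb : (v : F2^ n) (ws : Vec (F2^ n) k) (c : Vec Bool k) →
                     lincomb (map (absorb v) ws) c ≡ parity (lincomb ws c) · v ⊕ lincomb ws c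
lincomb-map-absorb {n} v [] [] =
  sym (trans (cong (λ b → b · v ⊕ zeroV) (parity-zeroV n)) (⊕-identityˡ zeroV))
lincomb-map-absorb v (w ∷ ws) (false ∷ c) = lincomb-map-absorb v ws c
lincomb-map-absorb v (w ∷ ws) (true ∷ c)  = begin
  (parity w · v ⊕ w) ⊕ lincomb (map (absorb v) ws) c ≡⟨ cong ((parity w · v ⊕ w) ⊕_) (lincomb-map-absorb v ws c) ⟩
  (parity w · v ⊕ w) ⊕ (parity L · v ⊕ L)            ≡⟨ ⊕-interchange (parity w · v) w _ L ⟩
  (parity w · v ⊕ parity L · v) ⊕ (w ⊕ L)            ≡⟨ cong (_⊕ (w ⊕ L)) (xor-· (parity w) (parity L) v) ⟨
  (parity w xor parity L) · v ⊕ (w ⊕ L)              ≡⟨ cong (λ b → b · v ⊕ (w ⊕ L)) (parity-⊕ w L) ⟨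
  parity (w ⊕ L) · v ⊕ (w ⊕ L)                       ∎
  where
  open ≡-Reasoning
  L = lincomb ws c

evenBasis : Vec (F2^ n) (suc k) → Vec (F2^ n) k
evenBasis (v ∷ vs) with parity v
evenBasis (v ∷ vs)     | true  = map (absorb v) vs
evenBasis (v ∷ [])     | false = []
evenBasis (v ∷ w ∷ ws) | false = v ∷ evenBasis (w ∷ ws)

evenCoeffs : Vec (F2^ n) (suc k) → Vec Bool k → Vec Bool (suc k)
evenCoeffs (v ∷ vs) c with parity v
evenCoeffs (v ∷ vs)     c       | true  = parity (lincomb vs c) ∷ c
evenCoeffs (v ∷ [])     []      | false = false ∷ []
evenCoeffs (v ∷ w ∷ ws) (t ∷ c) | false = t ∷ evenCoeffs (w ∷ ws) c

lincomb-evenBasis : (vs : Vec (F2^ n) (suc k)) (c : Vec Bool k) →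
                    lincomb (evenBasis vs) c ≡ lincomb vs (evenCoeffs vs c)
lincomb-evenBasis (v ∷ vs) c with parity v
lincomb-evenBasis (v ∷ vs) c | true =
  trans (lincomb-map-absorb v vs c) (sym (lincomb-∷ v vs (parity (lincomb vs c)) c))
lincomb-evenBasis (v ∷ []) [] | false = refl
lincomb-evenBasis (v ∷ w ∷ ws) (t ∷ c) | false = begin
  lincomb (v ∷ evenBasis (w ∷ ws)) (t ∷ c)          ≡⟨ lincomb-∷ v _ t c ⟩
  t · v ⊕ lincomb (evenBasis (w ∷ ws)) c            ≡⟨ cong (t · v ⊕_) (lincomb-evenBasis (w ∷ ws) c) ⟩
  t · v ⊕ lincomb (w ∷ ws) (evenCoeffs (w ∷ ws) c)  ≡⟨ lincomb-∷ v _ t _ ⟨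
  lincomb (v ∷ w ∷ ws) (t ∷ evenCoeffs (w ∷ ws) c)  ∎
  where open ≡-Reasoning

evenCoeffs-zeroV : (vs : Vec (F2^ n) (suc k)) (c : Vec Bool k) → evenCoeffs vs c ≡ zeroV → c ≡ zeroV
evenCoeffs-zeroV (v ∷ vs) c e with parity v
evenCoeffs-zeroV (v ∷ vs)     c       e | true  = ∷-injectiveʳ e
evenCoeffs-zeroV (v ∷ [])     []      e | false = refl
evenCoeffs-zeroV (v ∷ w ∷ ws) (t ∷ c) e | false =
  cong₂ _∷_ (∷-injectiveˡ e) (evenCoeffs-zeroV (w ∷ ws) c (∷-injectiveʳ e))

evenBasis-Even : (vs : Vec (F2^ n) (suc k)) → All Even (evenBasis vs)
evenBasis-Even (v ∷ vs) with parity v in pv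
evenBasis-Even (v ∷ vs)     | true  = map⁺ (universal (absorb-Even pv) vs)
evenBasis-Even (v ∷ [])     | false = []
evenBasis-Even (v ∷ w ∷ ws) | false = pv ∷ evenBasis-Even (w ∷ ws)

LinIndep-evenBasis : {vs : Vec (F2^ n) (suc k)} → LinIndep vs → LinIndep (evenBasis vs)
LinIndep-evenBasis {vs = vs} indep c e =
  evenCoeffs-zeroV vs c (indep _ (trans (sym (lincomb-evenBasis vs c)) e))

base∈C : (C : AffSub n k) → AffSub.base C ∈C C
base∈C (affSub base dirs _) =
  zeroV , sym (trans (cong (base ⊕_) (lincomb-zeroV dirs)) (⊕-identityʳ base))

∈C-⊕-lincomb : {C : AffSub n k} {x : F2^ n} → x ∈C C → ∀ c → (x ⊕ lincomb (AffSub.dirs C) c) ∈C C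
∈C-⊕-lincomb {C = affSub base dirs _} {x} (c₀ , refl) c = c₀ ⊕ c , (begin
  (base ⊕ lincomb dirs c₀) ⊕ lincomb dirs c ≡⟨ ⊕-assoc base _ _ ⟩
  base ⊕ (lincomb dirs c₀ ⊕ lincomb dirs c) ≡⟨ cong (base ⊕_) (lincomb-⊕ dirs c₀ c) ⟨
  base ⊕ lincomb dirs (c₀ ⊕ c)              ∎)
  where open ≡-Reasoning

evenSlice : AffSub n (suc k) → F2^ n → AffSub n k
evenSlice (affSub _ dirs indep) x = affSub x (evenBasis dirs) (LinIndep-evenBasis {vs = dirs} indep)

evenSlice⊆ : {C : AffSub n (suc k)} {x y : F2^ n} → x ∈C C → y ∈C evenSlice C x → y ∈C C
evenSlice⊆ {C = C} {x} x∈C (c , refl) =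
  subst (_∈C C) (cong (x ⊕_) (sym (lincomb-evenBasis (AffSub.dirs C) c)))
    (∈C-⊕-lincomb {C = C} x∈C (evenCoeffs (AffSub.dirs C) c))

evenSlice-parity : {C : AffSub n (suc k)} {x y : F2^ n} → y ∈C evenSlice C x → parity y ≡ parity x
evenSlice-parity {C = affSub _ dirs _} {x} (c , refl) = begin
  parity (x ⊕ lincomb (evenBasis dirs) c)          ≡⟨ parity-⊕ x _ ⟩
  parity x xor parity (lincomb (evenBasis dirs) c) ≡⟨ cong (parity x xor_) (lincomb-Even (evenBasis-Even dirs) c) ⟩
  parity x xor false                               ≡⟨ xor-identityʳ (parity x) ⟩
  parity x                                         ∎
  where open ≡-Reasoning

Attained-halve : ∀ {M} → Odd M → Attained n (2 * M) (suc k) → Attained n M k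
-- Matching the oddness witness exposes M = suc _, which supplies NonZero M for a % M.
Attained-halve {M = M} odd@(_ , refl) (C , a , _ , x₀ , x₀∈C , Hx₀≡a , unique) =
  evenSlice C x₀ , a % M , m%n≤n a M , x₀ , base∈C (evenSlice C x₀) ,
  mod-trans (Ham x₀) a (a % M) (mod-∣ (Ham x₀) a (n∣m*n 2) Hx₀≡a) (m≡m%n-mod a M) ,
  unique′
  where
  unique′ : ∀ y → y ∈C evenSlice C x₀ → Ham y ≡ a % M [mod M ] → y ≡ x₀
  unique′ y y∈ Hy≡a%M = unique y (evenSlice⊆ {C = C} x₀∈C y∈) (mod-2*odd (Ham y) a odd Hy≡a[2] Hy≡a[M])
    where
    Hy≡a[2] : Ham y ≡ a [mod 2 ]
    Hy≡a[2] = mod-trans (Ham y) (Ham x₀) a (parity⇒Ham-mod-2 y x₀ (evenSlice-parity {C = C} y∈))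
                                            (mod-∣ (Ham x₀) a (m∣m*n M) Hx₀≡a)
    Hy≡a[M] : Ham y ≡ a [mod M ]
    Hy≡a[M] = mod-trans (Ham y) (a % M) a Hy≡a%M (mod-sym a (a % M) (m≡m%n-mod a M))

proposition4p11 : (n M M' : ℕ) → 1 ≤ n → Odd M' → M ≡ 2 * M' →
    (d d' : ℕ) → IsD n M d → IsD n M' d' → d ≤ 1 + d'
proposition4p11 n M M' _ odd refl zero    d' _              _             = z≤n
proposition4p11 n M M' _ odd refl (suc k) d' (attained , _) (_ , maximal) =
  s≤s (maximal k (Attained-halve odd attained))
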